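{- Every orientation of a connected graph with maximum degree at most $4$ that has at least one vertex of degree at most $3$ admits a homomorphism to the Paley tournament $QR_{67}$.
   Context: A homomorphism of an oriented graph $G$ to an oriented graph $H$ is a map $\phi:V(G)\to V(H)$ such that $uv\in E(G)$ implies $\phi(u)\phi(v)\in E(H)$. The Paley tournament $QR_{67}$ has vertex set $\{0,1,\dots,66\}$ and an arc from $i$ to $j$ if and only if $j-i \not\equiv 0 \pmod{67}$ is a quadratic residue modulo $67$. -}

module Defs where

open import Data.Nat using (ℕ; zero; suc; _+_; _*_; _∸_; _≤_)
open import Data.Nat.DivMod using (_%_)
open import Data.Fin using (Fin; toℕ)
open import Data.Bool using (Bool; true; false; _∨_; _∧_; if_then_else_)
open import Data.List using (List; map; allFin)
open import Data.Nat.ListAction using (sum)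
open import Data.Product using (Σ; _×_; ∃; ∃-syntax)
open import Relation.Binary.PropositionalEquality using (_≡_; _≢_)

record OrientedGraph (n : ℕ) : Set where
  field
    arc        : Fin n → Fin n → Bool
    irreflexive : ∀ u → arc u u ≡ false
    antisym    : ∀ u v → arc u v ∧ arc v u ≡ false
open OrientedGraph public

adj : ∀ {n} → OrientedGraph n → Fin n → Fin n → Bool
adj G u v = arc G u v ∨ arc G v u

degree : ∀ {n} → OrientedGraph n → Fin n → ℕ
degree {n} G u = sum (map (λ w → if adj G u w then 1 else 0) (allFin n))

data Walk {n : ℕ} (G : OrientedGraph n) : Fin n → Fin n → Set where
  here : ∀ {u} → Walk G u u
  step : ∀ {u v w} → adj G u v ≡ true → Walk G v w → Walk G u w

Connected : ∀ {n} → OrientedGraph n → Set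
Connected {n} G = ∀ (u v : Fin n) → Walk G u v

IsQR67 : ℕ → Set
IsQR67 d = d % 67 ≢ 0 × ∃[ x ] (x * x) % 67 ≡ d % 67

-- Paley tournament QR_67: arc i → j iff j - i (mod 67) is a nonzero quadratic residue
QR67-arc : Fin 67 → Fin 67 → Set
QR67-arc i j = IsQR67 ((toℕ j + 67) ∸ toℕ i)

IsHomToQR67 : ∀ {n} → OrientedGraph n → (Fin n → Fin 67) → Set
IsHomToQR67 {n} G φ = ∀ (u v : Fin n) → arc G u v ≡ true → QR67-arc (φ u) (φ v)

module Submission where

-- Colour greedily, vertices far from a vertex r of degree at most 3 first, so that every vertex
-- other than r still has an uncoloured neighbour when it gets coloured. A vertex with k coloured
-- neighbours then meets k ≤ 3 constraints (an arc to or from a given colour) and has at most 4 - k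
-- uncoloured neighbours. Each of those sees at most 3 coloured neighbours, and the new colour avoids
-- their colours, so that every uncoloured vertex keeps seeing pairwise distinct colours: its
-- constraints will concern distinct vertices of QR₆₇. It remains to check that any k ≤ 3 distinct
-- vertices of QR₆₇ with prescribed arc directions have more than 12 - 3k common neighbours. The
-- maps x ↦ u x + a with u (resp. -u) a nonzero square are automorphisms (resp. anti-automorphisms)
-- of QR₆₇, so the first two vertices may be taken to be 0 and 1, leaving a finite computation.

open import Defs
open import Data.Nat using (ℕ; _≤_)
open import Data.Fin using (Fin)
open import Data.Product using (Σ; _×_; ∃; ∃-syntax)
open import Data.Nat using (zero; suc; _+_; _*_; _∸_; _^_; _<_; _<?_; _≡ᵇ_; z≤n; s≤s)
open import Data.Nat.DivMod using (_%_; %-distribˡ-+; %-distribˡ-*; m%n%n≡m%n; [m+kn]%n≡m%n; m%n<n; m<n⇒m%n≡m)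
open import Data.Nat.Divisibility using (m%n≡0⇒n∣m; n∣m⇒m%n≡0)
open import Data.Nat.ListAction using (sum)
open import Data.Nat.Primality using (Prime; prime?; euclidsLemma)
open import Data.Nat.Properties using (_≟_; allUpTo?; anyUpTo?; ≤-trans; <-≤-trans; ≤-<-trans; ≤-reflexive; <⇒≤; <⇒≱; m≤m+n; m≤n+m; m∸n+n≡m; +-comm; +-suc; +-mono-≤; +-monoˡ-≤; +-monoʳ-≤; +-cancelʳ-≤; +-cancelʳ-<; *-comm; *-assoc; *-suc; *-identityˡ; *-zeroʳ; *-distribˡ-+; *-monoʳ-≤; [m*n]*[o*p]≡[m*o]*[n*p]; ≤-pred; module ≤-Reasoning)
open import Data.Nat.Tactic.RingSolver using (solve-∀)
open import Data.Bool using (Bool; true; false; _∧_; _∨_; _xor_; if_then_else_; T)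
open import Data.Bool.Properties using (T?; ∨-comm) renaming (_≟_ to _≟ᴮ_)
open import Data.Empty using (⊥-elim)
open import Data.Fin using (toℕ; fromℕ<) renaming (zero to fzero)
open import Data.Fin.Properties using (toℕ<n; toℕ-injective; toℕ-fromℕ<; all?; ¬∀⟶∃¬) renaming (_≟_ to _≟ᶠ_)
open import Data.List using (List; []; _∷_; _++_; map; concatMap; length; filter; upTo; allFin)
open import Data.List.Properties using (length-map; length-++; length-filter; filter-notAll; length-tabulate)
open import Data.List.Membership.Propositional using (_∈_; _∉_; find; lose)
open import Data.List.Membership.Propositional.Properties using (∈-filter⁺; ∈-filter⁻; ∈-upTo⁺; ∈-upTo⁻; ∈-map⁺; ∈-allFin; ∈-concatMap⁺; ∈-length)
open import Data.List.Relation.Unary.All as All using (All; []; _∷_)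
import Data.List.Relation.Unary.All.Properties as All
open import Data.List.Relation.Unary.Any as Any using (here; there; any?)
open import Data.List.Relation.Unary.AllPairs as AllPairs using (AllPairs; []; _∷_)
import Data.List.Relation.Unary.AllPairs.Properties as AllPairs
open import Data.List.Relation.Unary.Unique.Propositional using (Unique)
open import Data.List.Relation.Unary.Unique.Propositional.Properties as Unique using (upTo⁺; allFin⁺)
open import Data.Product using (_,_; proj₁; proj₂; ∃₂; map₁)
open import Data.Sum using (_⊎_; inj₁; inj₂)
open import Data.Vec.Functional using (updateAt)
open import Data.Vec.Functional.Properties using (updateAt-updates; updateAt-minimal)
open import Function using (_∘_; id; const; _⇔_; mk⇔; Equivalence)
open import Level using (0ℓ)
open import Relation.Binary.Bundles using (Setoid)
open import Relation.Binary.Definitions using (DecidableEquality)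
open import Relation.Binary.PropositionalEquality using (_≡_; _≢_; refl; sym; trans; cong; cong₂; subst; subst₂; module ≡-Reasoning)
import Relation.Binary.Reasoning.Setoid as SetoidReasoning
open import Relation.Nullary using (Dec; yes; no; ¬?; contradiction)
open import Relation.Nullary.Decidable using (decidable-stable; toWitness; from-yes; map′; _×-dec_; _⊎-dec_; _→-dec_)
open import Relation.Unary using (Decidable)

module _ {A B : Set} (_≟ᴮ_ : DecidableEquality B) where

  length-≤-injection : (f : A → B) {xs : List A} {ys : List B} → Unique xs
                     → (∀ {x} → x ∈ xs → f x ∈ ys)
                     → (∀ {x y} → x ∈ xs → y ∈ xs → f x ≡ f y → x ≡ y)
                     → length xs ≤ length ys
  length-≤-injection f {[]} _ _ _ = z≤n
  length-≤-injection f {x ∷ xs} {ys} (x≢xs ∷ unique) into injective =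
    <-≤-trans (s≤s (length-≤-injection f unique into′ injective′)) shorter
    where
    ys′ : List B
    ys′ = filter (λ y → ¬? (y ≟ᴮ f x)) ys
    shorter : length ys′ < length ys
    shorter = filter-notAll _ ys (Any.map (λ fx≡y y≢fx → y≢fx (sym fx≡y)) (into (here refl)))
    injective′ : ∀ {y z} → y ∈ xs → z ∈ xs → f y ≡ f z → y ≡ z
    injective′ y∈ z∈ = injective (there y∈) (there z∈)
    into′ : ∀ {y} → y ∈ xs → f y ∈ ys′
    into′ y∈ = ∈-filter⁺ _ (into (there y∈))
                 (λ fy≡fx → All.lookup x≢xs y∈ (sym (injective (there y∈) (here refl) fy≡fx)))

module _ {A : Set} (_≟ᴬ_ : DecidableEquality A) where
  open import Data.List.Membership.DecPropositional _≟ᴬ_ using (_∈?_; _∉?_)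

  ∃∉-if-longer : ∀ {xs ys : List A} → Unique xs → length ys < length xs → ∃[ x ] x ∈ xs × x ∉ ys
  ∃∉-if-longer {xs} {ys} unique longer with any? (_∉? ys) xs
  ... | yes some = find some
  ... | no none = ⊥-elim (<⇒≱ longer (length-≤-injection _≟ᴬ_ id unique
                    (λ {x} x∈ → decidable-stable (x ∈? ys) (none ∘ lose x∈)) (λ _ _ eq → eq)))

module _ {A : Set} where

  sum-indicator≡length-filter : (p : A → Bool) (xs : List A)
    → sum (map (λ x → if p x then 1 else 0) xs) ≡ length (filter (λ x → p x ≟ᴮ true) xs)
  sum-indicator≡length-filter p [] = refl
  sum-indicator≡length-filter p (x ∷ xs) with p x
  ... | true  = cong suc (sum-indicator≡length-filter p xs)
  ... | false = sum-indicator≡length-filter p xs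

  length-filter+∁ : ∀ {P : A → Set} (P? : Decidable P) xs
                  → length (filter P? xs) + length (filter (¬? ∘ P?) xs) ≡ length xs
  length-filter+∁ P? [] = refl
  length-filter+∁ P? (x ∷ xs) with P? x
  ... | yes _ = cong suc (length-filter+∁ P? xs)
  ... | no _  = trans (+-suc _ _) (cong suc (length-filter+∁ P? xs))

  length-concatMap-≤ : ∀ {B : Set} (f : A → List B) {k} xs → (∀ {x} → x ∈ xs → length (f x) ≤ k)
                     → length (concatMap f xs) ≤ k * length xs
  length-concatMap-≤ f [] _ = z≤n
  length-concatMap-≤ f {k} (x ∷ xs) bounded = begin
    length (f x ++ concatMap f xs)         ≡⟨ length-++ (f x) ⟩
    length (f x) + length (concatMap f xs) ≤⟨ +-mono-≤ (bounded (here refl))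
                                                        (length-concatMap-≤ f xs (bounded ∘ there)) ⟩
    k + k * length xs                      ≡⟨ *-suc k (length xs) ⟨
    k * suc (length xs)                    ∎
    where open ≤-Reasoning

  AllPairs-mapWithAll : ∀ {P : A → Set} {R S : A → A → Set} {xs}
                      → (∀ {x y} → P x → P y → R x y → S x y) → All P xs → AllPairs R xs → AllPairs S xs
  AllPairs-mapWithAll f [] [] = []
  AllPairs-mapWithAll f (px ∷ pxs) (rx ∷ rxs) =
    All.zipWith (λ (py , r) → f px py r) (pxs , rx) ∷ AllPairs-mapWithAll f pxs rxs

-- Arithmetic modulo 67 and the arcs of QR₆₇

infix 4 _≈_
-- congruence modulo 67; a record, so that its arguments can be inferred
record _≈_ (x y : ℕ) : Set where
  constructor mod67
  field ≡-mod67 : x % 67 ≡ y % 67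
open _≈_

≈-refl : ∀ {x} → x ≈ x
≈-refl = mod67 refl

≈-sym : ∀ {x y} → x ≈ y → y ≈ x
≈-sym (mod67 eq) = mod67 (sym eq)

≈-trans : ∀ {x y z} → x ≈ y → y ≈ z → x ≈ z
≈-trans (mod67 eq) (mod67 eq′) = mod67 (trans eq eq′)

≈-+ : ∀ {a b c d} → a ≈ b → c ≈ d → a + c ≈ b + d
≈-+ {a} {b} {c} {d} (mod67 a≈b) (mod67 c≈d) = mod67 (begin
  (a + c) % 67            ≡⟨ %-distribˡ-+ a c 67 ⟩
  (a % 67 + c % 67) % 67  ≡⟨ cong₂ (λ x y → (x + y) % 67) a≈b c≈d ⟩
  (b % 67 + d % 67) % 67  ≡⟨ %-distribˡ-+ b d 67 ⟨
  (b + d) % 67            ∎)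
  where open ≡-Reasoning

≈-* : ∀ {a b c d} → a ≈ b → c ≈ d → a * c ≈ b * d
≈-* {a} {b} {c} {d} (mod67 a≈b) (mod67 c≈d) = mod67 (begin
  (a * c) % 67              ≡⟨ %-distribˡ-* a c 67 ⟩
  (a % 67 * (c % 67)) % 67  ≡⟨ cong₂ (λ x y → (x * y) % 67) a≈b c≈d ⟩
  (b % 67 * (d % 67)) % 67  ≡⟨ %-distribˡ-* b d 67 ⟨
  (b * d) % 67              ∎)
  where open ≡-Reasoning

≡⇒≈ : ∀ {x y} → x ≡ y → x ≈ y
≡⇒≈ refl = ≈-refl

≈-setoid : Setoid 0ℓ 0ℓ
≈-setoid = record
  { Carrier       = ℕ
  ; _≈_           = _≈_
  ; isEquivalence = record { refl = ≈-refl ; sym = ≈-sym ; trans = ≈-trans }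
  }

module ≈-Reasoning = SetoidReasoning ≈-setoid

%-≈ : ∀ x → x % 67 ≈ x
%-≈ x = mod67 (m%n%n≡m%n x 67)

+*67-≈ : ∀ x k → x + k * 67 ≈ x
+*67-≈ x k = mod67 ([m+kn]%n≡m%n x k 67)

≈⇒≡ : ∀ {x y} → x < 67 → y < 67 → x ≈ y → x ≡ y
≈⇒≡ x<67 y<67 (mod67 eq) = trans (sym (m<n⇒m%n≡m x<67)) (trans eq (m<n⇒m%n≡m y<67))

-- j − i modulo 67, without truncated subtraction
infixl 6 _⊖_
_⊖_ : ℕ → ℕ → ℕ
j ⊖ i = j + 66 * i

⊖-cong : ∀ {i i′ j j′} → i ≈ i′ → j ≈ j′ → j ⊖ i ≈ j′ ⊖ i′
⊖-cong i≈i′ j≈j′ = ≈-+ j≈j′ (≈-* (≈-refl {66}) i≈i′)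

⊖-+ : ∀ i j → j ⊖ i + i ≈ j
⊖-+ i j = ≈-trans (≡⇒≈ (identity i j)) (+*67-≈ j i)
  where
  identity : ∀ i j → j + 66 * i + i ≡ j + i * 67
  identity = solve-∀

+-⊖ : ∀ a x → x + a ⊖ a ≈ x
+-⊖ a x = ≈-trans (≡⇒≈ (identity a x)) (+*67-≈ x a)
  where
  identity : ∀ a x → x + a + 66 * a ≡ x + a * 67
  identity = solve-∀

⊖-affine : ∀ u a i j → (u * j + a) ⊖ (u * i + a) ≈ u * (j ⊖ i)
⊖-affine u a i j = ≈-trans (≡⇒≈ (identity u a i j)) (+*67-≈ (u * (j ⊖ i)) a)
  where
  identity : ∀ u a i j → u * j + a + 66 * (u * i + a) ≡ u * (j + 66 * i) + a * 67
  identity = solve-∀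

⊖-swap : ∀ i j → i ⊖ j ≈ 66 * (j ⊖ i)
⊖-swap i j = ≈-sym (≈-trans (≡⇒≈ (identity i j)) (+*67-≈ (i ⊖ j) (65 * i)))
  where
  identity : ∀ i j → 66 * (j + 66 * i) ≡ i + 66 * j + 65 * i * 67
  identity = solve-∀

∸-≈-⊖ : ∀ {i} j → i ≤ j + 67 → (j + 67) ∸ i ≈ j ⊖ i
∸-≈-⊖ {i} j i≤j+67 = begin
  t                ≈⟨ +*67-≈ t i ⟨
  t + i * 67       ≡⟨ identity₁ t i ⟩
  t + i + 66 * i   ≡⟨ cong (_+ 66 * i) (m∸n+n≡m i≤j+67) ⟩
  j + 67 + 66 * i  ≡⟨ identity₂ i j ⟩
  j ⊖ i + 1 * 67   ≈⟨ +*67-≈ (j ⊖ i) 1 ⟩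
  j ⊖ i            ∎
  where
  open ≈-Reasoning
  t = (j + 67) ∸ i
  identity₁ : ∀ t i → t + i * 67 ≡ t + i + 66 * i
  identity₁ = solve-∀
  identity₂ : ∀ i j → j + 67 + 66 * i ≡ j + 66 * i + 1 * 67
  identity₂ = solve-∀

IsQR67-resp : ∀ {a b} → a ≈ b → IsQR67 a → IsQR67 b
IsQR67-resp (mod67 a≈b) (a≢0 , x , x²≈a) = (λ b≡0 → a≢0 (trans a≈b b≡0)) , x , trans x²≈a a≈b

prime67 : Prime 67
prime67 = from-yes (prime? 67)

%≢0-* : ∀ a b → a % 67 ≢ 0 → b % 67 ≢ 0 → a * b % 67 ≢ 0
%≢0-* a b a≢0 b≢0 ab≡0 with euclidsLemma a b prime67 (m%n≡0⇒n∣m (a * b) 67 ab≡0)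
... | inj₁ 67∣a = a≢0 (n∣m⇒m%n≡0 a 67 67∣a)
... | inj₂ 67∣b = b≢0 (n∣m⇒m%n≡0 b 67 67∣b)

IsQR67-* : ∀ {a b} → IsQR67 a → IsQR67 b → IsQR67 (a * b)
IsQR67-* {a} {b} (a≢0 , x , x²≈a) (b≢0 , y , y²≈b) = %≢0-* a b a≢0 b≢0 , x * y ,
  ≡-mod67 (≈-trans (≡⇒≈ ([m*n]*[o*p]≡[m*o]*[n*p] x y x y)) (≈-* {x * x} {a} {y * y} {b} (mod67 x²≈a) (mod67 y²≈b)))

IsQR67-1 : IsQR67 1
IsQR67-1 = (λ ()) , 1 , refl

Arc : ℕ → ℕ → Set
Arc i j = IsQR67 (j ⊖ i)

Arc-resp : ∀ {i i′ j j′} → i ≈ i′ → j ≈ j′ → Arc i j → Arc i′ j′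
Arc-resp i≈i′ j≈j′ = IsQR67-resp (⊖-cong i≈i′ j≈j′)

Arc-affine : ∀ u a i j → IsQR67 u → Arc i j → Arc (u * i + a) (u * j + a)
Arc-affine u a i j u∈QR i→j = IsQR67-resp (≈-sym (⊖-affine u a i j)) (IsQR67-* {u} {j ⊖ i} u∈QR i→j)

Arc-antiaffine : ∀ u a i j → IsQR67 (66 * u) → Arc i j → Arc (u * j + a) (u * i + a)
Arc-antiaffine u a i j -u∈QR i→j = IsQR67-resp (≈-sym reversed) (IsQR67-* {66 * u} {j ⊖ i} -u∈QR i→j)
  where
  open ≈-Reasoning
  reversed : (u * i + a) ⊖ (u * j + a) ≈ 66 * u * (j ⊖ i)
  reversed = begin
    (u * i + a) ⊖ (u * j + a)  ≈⟨ ⊖-affine u a j i ⟩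
    u * (i ⊖ j)                ≈⟨ ≈-* (≈-refl {u}) (⊖-swap i j) ⟩
    u * (66 * (j ⊖ i))         ≡⟨ *-assoc u 66 (j ⊖ i) ⟨
    u * 66 * (j ⊖ i)           ≡⟨ cong (_* (j ⊖ i)) (*-comm u 66) ⟩
    66 * u * (j ⊖ i)           ∎

Arc→QR67-arc : ∀ {i j : Fin 67} → Arc (toℕ i) (toℕ j) → QR67-arc i j
Arc→QR67-arc {i} {j} = IsQR67-resp (≈-sym (∸-≈-⊖ (toℕ j) (≤-trans (<⇒≤ (toℕ<n i)) (m≤n+m 67 (toℕ j)))))

Arc⟨_⟩ : Bool → ℕ → ℕ → Set
Arc⟨ true ⟩ c x = Arc c x
Arc⟨ false ⟩ c x = Arc x c

Arc⟨⟩-resp : ∀ b {c c′ x x′} → c ≈ c′ → x ≈ x′ → Arc⟨ b ⟩ c x → Arc⟨ b ⟩ c′ x′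
Arc⟨⟩-resp true c≈c′ x≈x′ = Arc-resp c≈c′ x≈x′
Arc⟨⟩-resp false c≈c′ x≈x′ = Arc-resp x≈x′ c≈c′

-- The flag r says whether x ↦ u * x + a reverses arcs, i.e. whether -u ≈ 66 * u rather than u is a
-- quadratic residue.
Arc⟨⟩-affine : ∀ r u a b i j → IsQR67 (if r then 66 * u else u)
             → Arc⟨ r xor b ⟩ i j → Arc⟨ b ⟩ (u * i + a) (u * j + a)
Arc⟨⟩-affine false u a true  i j = Arc-affine u a i j
Arc⟨⟩-affine false u a false i j = Arc-affine u a j i
Arc⟨⟩-affine true  u a true  i j = Arc-antiaffine u a j i
Arc⟨⟩-affine true  u a false i j = Arc-antiaffine u a i j

-- Common neighbours in QR₆₇

IsQR67-bounded : ℕ → Set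
IsQR67-bounded d = d % 67 ≢ 0 × ∃[ x ] x < 67 × x * x % 67 ≡ d % 67

isQR67-bounded? : ∀ d → Dec (IsQR67-bounded d)
isQR67-bounded? d = ¬? (d % 67 ≟ 0) ×-dec anyUpTo? (λ x → x * x % 67 ≟ d % 67) 67

IsQR67⇔bounded : ∀ {d} → IsQR67 d ⇔ IsQR67-bounded d
IsQR67⇔bounded = mk⇔
  (λ (d≢0 , x , x²≈d) → d≢0 , x % 67 , m%n<n x 67 , trans (≡-mod67 (≈-* (%-≈ x) (%-≈ x))) x²≈d)
  (λ (d≢0 , x , _ , x²≈d) → d≢0 , x , x²≈d)

-- Euler's criterion; it is checked for each residue class below rather than proved.
euler : ℕ → Bool
euler d = d ^ 33 % 67 ≡ᵇ 1

euler-criterion : ∀ {d} → d < 67 → T (euler d) ⇔ IsQR67 d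
euler-criterion {d} d<67 = let (⇒ , ⇐) = checked d<67 in
  mk⇔ (Equivalence.from (IsQR67⇔bounded {d}) ∘ ⇒) (⇐ ∘ Equivalence.to (IsQR67⇔bounded {d}))
  where
  checked : ∀ {d} → d < 67 → (T (euler d) → IsQR67-bounded d) × (IsQR67-bounded d → T (euler d))
  checked = toWitness {a? = allUpTo? (λ d → (T? (euler d) →-dec isQR67-bounded? d)
                                   ×-dec (isQR67-bounded? d →-dec T? (euler d))) 67} _

isQR67? : ∀ d → Dec (IsQR67 d)
isQR67? d = map′ (IsQR67-resp (%-≈ d) ∘ Equivalence.to criterion)
                 (Equivalence.from criterion ∘ IsQR67-resp (≈-sym (%-≈ d)))
                 (T? (euler (d % 67)))
  where criterion = euler-criterion (m%n<n d 67)

Constraint : Set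
Constraint = ℕ × Bool

Respects : ℕ → Constraint → Set
Respects x (c , b) = Arc⟨ b ⟩ c x

respects? : ∀ x cb → Dec (Respects x cb)
respects? x (c , true)  = isQR67? (x ⊖ c)
respects? x (c , false) = isQR67? (c ⊖ x)

respectsAll? : ∀ cs x → Dec (All (Respects x) cs)
respectsAll? cs x = All.all? (respects? x) cs

solutions : List Constraint → List ℕ
solutions cs = filter (respectsAll? cs) (upTo 67)

∈-solutions⁺ : ∀ {x} cs → x < 67 → All (Respects x) cs → x ∈ solutions cs
∈-solutions⁺ cs x<67 = ∈-filter⁺ (respectsAll? cs) (∈-upTo⁺ x<67)

∈-solutions⁻ : ∀ {x} cs → x ∈ solutions cs → x < 67 × All (Respects x) cs
∈-solutions⁻ cs x∈ = let (x∈upTo , respects) = ∈-filter⁻ (respectsAll? cs) x∈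
                     in ∈-upTo⁻ {n = 67} x∈upTo , respects

solutions-unique : ∀ cs → Unique (solutions cs)
solutions-unique cs = Unique.filter⁺ (respectsAll? cs) (upTo⁺ 67)

-- A record, so that the type checker compares bounds without evaluating the solution counts.
record Bound (cs : List Constraint) : Set where
  constructor mkBound
  field bound : 12 < 3 * length cs + length (solutions cs)
open Bound

bound? : ∀ cs → Dec (Bound cs)
bound? cs = map′ mkBound bound (12 <? 3 * length cs + length (solutions cs))

∀-Bool? : {P : Bool → Set} → (∀ b → Dec (P b)) → Dec (∀ b → P b)
∀-Bool? P? with P? true | P? false
... | yes t | yes f = yes λ { true → t ; false → f }
... | no ¬t | _     = no λ all → ¬t (all true)
... | _     | no ¬f = no λ all → ¬f (all false)

bound-[] : Bound []
bound-[] = toWitness {a? = bound? []} _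

bound-0 : ∀ b₀ → Bound ((0 , b₀) ∷ [])
bound-0 = toWitness {a? = ∀-Bool? λ b₀ → bound? ((0 , b₀) ∷ [])} _

bound-0-1 : ∀ b₀ b₁ → Bound ((0 , b₀) ∷ (1 , b₁) ∷ [])
bound-0-1 = toWitness {a? = ∀-Bool? λ b₀ → ∀-Bool? λ b₁ → bound? ((0 , b₀) ∷ (1 , b₁) ∷ [])} _

bound-0-1-c : ∀ {c} → c < 67 → c ≢ 0 → c ≢ 1 → ∀ b₀ b₁ b₂ → Bound ((0 , b₀) ∷ (1 , b₁) ∷ (c , b₂) ∷ [])
bound-0-1-c = toWitness {a? = allUpTo? (λ c → ¬? (c ≟ 0) →-dec ¬? (c ≟ 1) →-dec
           ∀-Bool? λ b₀ → ∀-Bool? λ b₁ → ∀-Bool? λ b₂ → bound? ((0 , b₀) ∷ (1 , b₁) ∷ (c , b₂) ∷ [])) 67} _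

module Affine (r : Bool) {u v : ℕ} (a : ℕ) (orientation : IsQR67 (if r then 66 * u else u))
              (inverse : u * v ≈ 1) where
  open ≈-Reasoning

  to : ℕ → ℕ
  to x = (u * x + a) % 67

  from : ℕ → ℕ
  from y = v * (y ⊖ a) % 67

  to∘from : ∀ y → u * from y + a ≈ y
  to∘from y = begin
    u * from y + a            ≈⟨ ≈-+ (≈-* (≈-refl {u}) (%-≈ (v * (y ⊖ a)))) (≈-refl {a}) ⟩
    u * (v * (y ⊖ a)) + a     ≡⟨ cong (_+ a) (*-assoc u v (y ⊖ a)) ⟨
    u * v * (y ⊖ a) + a       ≈⟨ ≈-+ (≈-* inverse (≈-refl {y ⊖ a})) (≈-refl {a}) ⟩
    1 * (y ⊖ a) + a           ≡⟨ cong (_+ a) (*-identityˡ (y ⊖ a)) ⟩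
    y ⊖ a + a                 ≈⟨ ⊖-+ a y ⟩
    y                         ∎

  from∘to : ∀ x → from (to x) ≈ x
  from∘to x = begin
    from (to x)               ≈⟨ %-≈ (v * (to x ⊖ a)) ⟩
    v * (to x ⊖ a)            ≈⟨ ≈-* (≈-refl {v}) (⊖-cong (≈-refl {a}) (%-≈ (u * x + a))) ⟩
    v * (u * x + a ⊖ a)       ≈⟨ ≈-* (≈-refl {v}) (+-⊖ a (u * x)) ⟩
    v * (u * x)               ≡⟨ trans (sym (*-assoc v u x)) (cong (_* x) (*-comm v u)) ⟩
    u * v * x                 ≈⟨ ≈-* inverse (≈-refl {x}) ⟩
    1 * x                     ≡⟨ *-identityˡ x ⟩
    x                         ∎

  from-injective : ∀ {y y′} → from y ≡ from y′ → y ≈ y′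
  from-injective {y} {y′} eq =
    ≈-trans (≈-sym (to∘from y)) (≈-trans (≡⇒≈ (cong (λ z → u * z + a) eq)) (to∘from y′))

  from-base : from a ≡ 0
  from-base = ≡-mod67 (≈-trans (≈-* (≈-refl {v}) (+-⊖ a 0)) (≡⇒≈ (*-zeroʳ v)))

  pull : Constraint → Constraint
  pull (c , b) = from c , r xor b

  pull-respects : ∀ {y} cb → Respects y (pull cb) → Respects (to y) cb
  pull-respects {y} (c , b) = Arc⟨⟩-resp b (to∘from c) (≈-sym (%-≈ (u * y + a)))
                            ∘ Arc⟨⟩-affine r u a b (from c) y orientation

  solutions-pull : ∀ cs → length (solutions (map pull cs)) ≤ length (solutions cs)
  solutions-pull cs = length-≤-injection _≟_ to (solutions-unique (map pull cs)) into injective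
    where
    into : ∀ {y} → y ∈ solutions (map pull cs) → to y ∈ solutions cs
    into {y} y∈ = ∈-solutions⁺ cs (m%n<n (u * y + a) 67)
                (All.map (pull-respects _) (All.map⁻ (proj₂ (∈-solutions⁻ (map pull cs) y∈))))
    injective : ∀ {x y} → x ∈ solutions (map pull cs) → y ∈ solutions (map pull cs) → to x ≡ to y → x ≡ y
    injective {x} {y} x∈ y∈ eq =
      ≈⇒≡ (proj₁ (∈-solutions⁻ (map pull cs) x∈)) (proj₁ (∈-solutions⁻ (map pull cs) y∈))
          (≈-trans (≈-sym (from∘to x)) (≈-trans (≡⇒≈ (cong from eq)) (from∘to y)))

  bound-pull : ∀ cs → Bound (map pull cs) → Bound cs
  bound-pull cs (mkBound pulled) = mkBound (<-≤-trans pulled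
    (+-mono-≤ (≤-reflexive (cong (3 *_) (length-map pull cs))) (solutions-pull cs)))

bound-singleton : ∀ c₀ b₀ → Bound ((c₀ , b₀) ∷ [])
bound-singleton c₀ b₀ =
  bound-pull ((c₀ , b₀) ∷ []) (subst (λ c → Bound ((c , b₀) ∷ [])) (sym from-base) (bound-0 b₀))
  where open Affine false {1} {1} c₀ IsQR67-1 ≈-refl

inverse67 : ∀ {u} → u < 67 → u ≢ 0 → ∃[ v ] u * v ≈ 1
inverse67 u<67 u≢0 = let (v , _ , uv≡1) = checked u<67 u≢0 in v , mod67 uv≡1
  where
  checked : ∀ {u} → u < 67 → u ≢ 0 → ∃[ v ] v < 67 × u * v % 67 ≡ 1
  checked = toWitness {a? = allUpTo? (λ u → ¬? (u ≟ 0) →-dec anyUpTo? (λ v → u * v % 67 ≟ 1) 67) 67} _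

QR67-or-negated : ∀ {u} → u < 67 → u ≢ 0 → IsQR67 u ⊎ IsQR67 (66 * u)
QR67-or-negated = toWitness {a? = allUpTo? (λ u → ¬? (u ≟ 0) →-dec (isQR67? u ⊎-dec isQR67? (66 * u))) 67} _

-- Moving c₀ to 0 and c₁ to 1 by an affine (anti-)automorphism of QR₆₇.
module Normalise {c₀ c₁} (c₀<67 : c₀ < 67) (c₁<67 : c₁ < 67) (c₀≢c₁ : c₀ ≢ c₁) where

  u : ℕ
  u = (c₁ ⊖ c₀) % 67

  u≢0 : u ≢ 0
  u≢0 u≡0 = c₀≢c₁ (≈⇒≡ c₀<67 c₁<67 (≈-trans (≈-+ (≈-sym (mod67 u≡0)) (≈-refl {c₀})) (⊖-+ c₀ c₁)))

  sign : ∃[ r ] IsQR67 (if r then 66 * u else u)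
  sign = orientation (QR67-or-negated (m%n<n (c₁ ⊖ c₀) 67) u≢0)
    where
    orientation : IsQR67 u ⊎ IsQR67 (66 * u) → ∃[ r ] IsQR67 (if r then 66 * u else u)
    orientation (inj₁ u∈QR)  = false , u∈QR
    orientation (inj₂ -u∈QR) = true , -u∈QR

  r : Bool
  r = proj₁ sign

  v : ℕ
  v = proj₁ (inverse67 (m%n<n (c₁ ⊖ c₀) 67) u≢0)

  uv≈1 : u * v ≈ 1
  uv≈1 = proj₂ (inverse67 (m%n<n (c₁ ⊖ c₀) 67) u≢0)

  open Affine r c₀ (proj₂ sign) uv≈1 public

  from-c₁ : from c₁ ≡ 1
  from-c₁ = ≡-mod67 (≈-trans (≈-* (≈-refl {v}) (≈-sym (%-≈ (c₁ ⊖ c₀)))) (≈-trans (≡⇒≈ (*-comm v u)) uv≈1))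

  from-≢ : ∀ {c} → c < 67 → c ≢ c₀ → c ≢ c₁ → from c ≢ 0 × from c ≢ 1
  from-≢ c<67 c≢c₀ c≢c₁ =
    (λ eq → c≢c₀ (≈⇒≡ c<67 c₀<67 (from-injective (trans eq (sym from-base))))) ,
    (λ eq → c≢c₁ (≈⇒≡ c<67 c₁<67 (from-injective (trans eq (sym from-c₁)))))

  bound-pair : ∀ b₀ b₁ → Bound ((c₀ , b₀) ∷ (c₁ , b₁) ∷ [])
  bound-pair b₀ b₁ = bound-pull ((c₀ , b₀) ∷ (c₁ , b₁) ∷ [])
    (subst₂ (λ z o → Bound ((z , r xor b₀) ∷ (o , r xor b₁) ∷ [])) (sym from-base) (sym from-c₁)
      (bound-0-1 (r xor b₀) (r xor b₁)))

  bound-triple : ∀ {c₂} → c₂ < 67 → c₂ ≢ c₀ → c₂ ≢ c₁ → ∀ b₀ b₁ b₂ → Bound ((c₀ , b₀) ∷ (c₁ , b₁) ∷ (c₂ , b₂) ∷ [])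
  bound-triple {c₂} c₂<67 c₂≢c₀ c₂≢c₁ b₀ b₁ b₂ = bound-pull ((c₀ , b₀) ∷ (c₁ , b₁) ∷ (c₂ , b₂) ∷ [])
    (subst₂ (λ z o → Bound ((z , r xor b₀) ∷ (o , r xor b₁) ∷ (from c₂ , r xor b₂) ∷ [])) (sym from-base) (sym from-c₁)
      (bound-0-1-c (m%n<n (v * (c₂ ⊖ c₀)) 67) (proj₁ from-c₂) (proj₂ from-c₂) (r xor b₀) (r xor b₁) (r xor b₂)))
    where from-c₂ = from-≢ c₂<67 c₂≢c₀ c₂≢c₁

bound-distinct : ∀ cs → length cs ≤ 3 → All ((_< 67) ∘ proj₁) cs → Unique (map proj₁ cs) → Bound cs
bound-distinct [] _ _ _ = bound-[]
bound-distinct ((c₀ , b₀) ∷ []) _ _ _ = bound-singleton c₀ b₀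
bound-distinct ((c₀ , b₀) ∷ (c₁ , b₁) ∷ []) _ (c₀<67 ∷ c₁<67 ∷ []) ((c₀≢c₁ ∷ []) ∷ _) =
  Normalise.bound-pair c₀<67 c₁<67 c₀≢c₁ b₀ b₁
bound-distinct ((c₀ , b₀) ∷ (c₁ , b₁) ∷ (c₂ , b₂) ∷ []) _ (c₀<67 ∷ c₁<67 ∷ c₂<67 ∷ [])
               ((c₀≢c₁ ∷ c₀≢c₂ ∷ []) ∷ (c₁≢c₂ ∷ []) ∷ _) =
  Normalise.bound-triple c₀<67 c₁<67 c₀≢c₁ c₂<67 (c₀≢c₂ ∘ sym) (c₁≢c₂ ∘ sym) b₀ b₁ b₂
bound-distinct (_ ∷ _ ∷ _ ∷ _ ∷ _) (s≤s (s≤s (s≤s ()))) _ _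

solution-avoiding : ∀ cs → length cs ≤ 3 → All ((_< 67) ∘ proj₁) cs → Unique (map proj₁ cs)
                  → ∀ F → length F + 3 * length cs ≤ 12 → ∃[ x ] x < 67 × x ∉ F × All (Respects x) cs
solution-avoiding cs k≤3 cs<67 unique F room =
  let (x , x∈ , x∉F) = ∃∉-if-longer _≟_ (solutions-unique cs) F-shorter
      (x<67 , respects) = ∈-solutions⁻ cs x∈
  in x , x<67 , x∉F , respects
  where
  F-shorter : length F < length (solutions cs)
  F-shorter = +-cancelʳ-< (3 * length cs) (length F) (length (solutions cs))
    (≤-<-trans room (subst (12 <_) (+-comm (3 * length cs) _) (bound (bound-distinct cs k≤3 cs<67 unique))))

QR67-arc⟨_⟩ : Bool → Fin 67 → Fin 67 → Set
QR67-arc⟨ true ⟩ c x = QR67-arc c x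
QR67-arc⟨ false ⟩ c x = QR67-arc x c

Arc⟨⟩→QR67-arc⟨⟩ : ∀ b {c x : Fin 67} → Arc⟨ b ⟩ (toℕ c) (toℕ x) → QR67-arc⟨ b ⟩ c x
Arc⟨⟩→QR67-arc⟨⟩ true  {c} {x} = Arc→QR67-arc {c} {x}
Arc⟨⟩→QR67-arc⟨⟩ false {c} {x} = Arc→QR67-arc {x} {c}

QR67-extension : (cs : List (Fin 67 × Bool)) → length cs ≤ 3 → Unique (map proj₁ cs)
               → (F : List (Fin 67)) → length F + 3 * length cs ≤ 12
               → ∃[ x ] x ∉ F × All (λ (c , b) → QR67-arc⟨ b ⟩ c x) cs
QR67-extension cs k≤3 unique F room =
  let (x , x<67 , x∉F , respects) = solution-avoiding csℕ k≤3′ csℕ<67 uniqueℕ (map toℕ F) room′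
      toℕ-x = toℕ-fromℕ< x<67
  in fromℕ< x<67
   , (λ x∈F → x∉F (subst (_∈ map toℕ F) toℕ-x (∈-map⁺ toℕ x∈F)))
   , All.map (λ {(c , b)} → Arc⟨⟩→QR67-arc⟨⟩ b ∘ subst (Arc⟨ b ⟩ (toℕ c)) (sym toℕ-x)) (All.map⁻ respects)
  where
  csℕ : List Constraint
  csℕ = map (map₁ toℕ) cs
  k≤3′ : length csℕ ≤ 3
  k≤3′ = subst (_≤ 3) (sym (length-map _ cs)) k≤3
  csℕ<67 : All ((_< 67) ∘ proj₁) csℕ
  csℕ<67 = All.map⁺ (All.universal (λ (c , _) → toℕ<n c) cs)
  uniqueℕ : Unique (map proj₁ csℕ)
  uniqueℕ = AllPairs.map⁺ (AllPairs.map⁺ (AllPairs.map (_∘ toℕ-injective) (AllPairs.map⁻ unique)))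
  room′ : length (map toℕ F) + 3 * length csℕ ≤ 12
  room′ = subst₂ (λ f k → f + 3 * k ≤ 12) (sym (length-map toℕ F)) (sym (length-map _ cs)) room

-- Colouring

module _ {n : ℕ} (G : OrientedGraph n) where
  open import Data.List.Membership.DecPropositional (_≟ᶠ_ {n}) using (_∈?_)

  adj-sym : ∀ u v → adj G u v ≡ adj G v u
  adj-sym u v = ∨-comm (arc G u v) (arc G v u)

  adj-irreflexive : ∀ v → adj G v v ≡ false
  adj-irreflexive v = cong (λ b → b ∨ b) (irreflexive G v)

  adj⇒≢ : ∀ {u v} → adj G u v ≡ true → v ≢ u
  adj⇒≢ {u} uv refl = contradiction (trans (sym uv) (adj-irreflexive u)) λ ()

  arc⇒adj : ∀ {u w} → arc G u w ≡ true → adj G u w ≡ true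
  arc⇒adj uw rewrite uw = refl

  arc⇒adj⁻ : ∀ {u w} → arc G u w ≡ true → adj G w u ≡ true
  arc⇒adj⁻ {u} {w} uw = trans (adj-sym w u) (arc⇒adj uw)

  arc⇒no-reverse : ∀ {u w} → arc G u w ≡ true → arc G w u ≡ false
  arc⇒no-reverse {u} {w} uw = trans (cong (_∧ arc G w u) (sym uw)) (antisym G u w)

  neighbours : Fin n → List (Fin n)
  neighbours v = filter (λ w → adj G v w ≟ᴮ true) (allFin n)

  ∈-neighbours⁺ : ∀ {v w} → adj G v w ≡ true → w ∈ neighbours v
  ∈-neighbours⁺ {v} {w} = ∈-filter⁺ (λ w → adj G v w ≟ᴮ true) (∈-allFin w)

  ∈-neighbours⁻ : ∀ {v w} → w ∈ neighbours v → adj G v w ≡ true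
  ∈-neighbours⁻ {v} w∈ = proj₂ (∈-filter⁻ (λ w → adj G v w ≟ᴮ true) {xs = allFin n} w∈)

  neighbours-unique : ∀ v → Unique (neighbours v)
  neighbours-unique v = Unique.filter⁺ (λ w → adj G v w ≟ᴮ true) (allFin⁺ n)

  degree≡length-neighbours : ∀ v → degree G v ≡ length (neighbours v)
  degree≡length-neighbours v = sum-indicator≡length-filter (adj G v) (allFin n)

  -- Colouring along such a list, every vertex but r still has an uncoloured neighbour.
  data RootedOrder (r : Fin n) : List (Fin n) → Set where
    root : RootedOrder r (r ∷ [])
    grow : ∀ {v u vs} → RootedOrder r vs → v ∉ vs → u ∈ vs → adj G v u ≡ true → RootedOrder r (v ∷ vs)

  RootedOrder-unique : ∀ {r vs} → RootedOrder r vs → Unique vs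
  RootedOrder-unique root = [] ∷ []
  RootedOrder-unique (grow order v∉vs _ _) = All.¬Any⇒All¬ _ v∉vs ∷ RootedOrder-unique order

  RootedOrder-root : ∀ {r vs} → RootedOrder r vs → r ∈ vs
  RootedOrder-root root = here refl
  RootedOrder-root (grow order _ _ _) = there (RootedOrder-root order)

  Unique⇒length≤ : ∀ {vs} → Unique vs → length vs ≤ n
  Unique⇒length≤ unique =
    ≤-trans (length-≤-injection (_≟ᶠ_ {n}) id {ys = allFin n} unique (λ {v} _ → ∈-allFin v) (λ _ _ eq → eq))
            (≤-reflexive (length-tabulate {n = n} id))

  crossing-edge : ∀ {vs u w} → Walk G u w → u ∉ vs → w ∈ vs → ∃₂ λ a b → a ∉ vs × b ∈ vs × adj G a b ≡ true
  crossing-edge here u∉vs u∈vs = ⊥-elim (u∉vs u∈vs)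
  crossing-edge {vs} (step {u} {v} uv walk) u∉vs w∈vs with v ∈? vs
  ... | yes v∈vs = u , v , u∉vs , v∈vs , uv
  ... | no v∉vs  = crossing-edge walk v∉vs w∈vs

  spanning-order : Connected G → ∀ r → ∃[ vs ] RootedOrder r vs × (∀ v → v ∈ vs)
  spanning-order connected r = extend n root (m≤m+n n 1)
    where
    extend : ∀ k {vs} → RootedOrder r vs → n ≤ k + length vs → ∃[ ws ] RootedOrder r ws × (∀ v → v ∈ ws)
    extend k {vs} order n≤k+|vs| with all? (_∈? vs)
    ... | yes spanning = vs , order , spanning
    ... | no ¬spanning with v , v∉vs ← ¬∀⟶∃¬ n _ (_∈? vs) ¬spanning
                       with a , b , a∉vs , b∈vs , ab ← crossing-edge (connected v r) v∉vs (RootedOrder-root order)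
                       with k
    ...   | zero  = ⊥-elim (<⇒≱ (Unique⇒length≤ (RootedOrder-unique (grow order a∉vs b∈vs ab))) n≤k+|vs|)
    ...   | suc k = extend k (grow order a∉vs b∈vs ab) (subst (n ≤_) (sym (+-suc k (length vs))) n≤k+|vs|)

module Colouring {n : ℕ} (G : OrientedGraph n) (degree≤4 : ∀ v → degree G v ≤ 4) where
  open import Data.List.Membership.DecPropositional (_≟ᶠ_ {n}) using (_∈?_; _∉?_)

  -- U lists the uncoloured vertices; separating makes the constraints that a vertex meets when it
  -- gets coloured concern distinct colours.
  record Admissible (U : List (Fin n)) (φ : Fin n → Fin 67) : Set where
    field
      homomorphic : ∀ {u w} → u ∉ U → w ∉ U → arc G u w ≡ true → QR67-arc (φ u) (φ w)
      separating  : ∀ {w a b} → w ∈ U → a ∉ U → b ∉ U → adj G w a ≡ true → adj G w b ≡ true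
                  → a ≢ b → φ a ≢ φ b

  nothing-coloured : ∀ {U} φ → (∀ v → v ∈ U) → Admissible U φ
  nothing-coloured φ all∈U = record
    { homomorphic = λ {u} u∉U _ _ → ⊥-elim (u∉U (all∈U u))
    ; separating  = λ {_} {a} _ a∉U _ _ _ _ → ⊥-elim (a∉U (all∈U a))
    }

  module Step {v U φ} (admissible : Admissible (v ∷ U) φ)
              (free : degree G v ≤ 3 ⊎ ∃[ u ] u ∈ U × adj G v u ≡ true) where
    open Admissible admissible

    uncoloured coloured : List (Fin n)
    uncoloured = filter (_∈? U) (neighbours G v)
    coloured   = filter (_∉? U) (neighbours G v)

    seen : Fin n → List (Fin n)
    seen w = filter (_∉? (v ∷ U)) (neighbours G w)

    forbidden : List (Fin 67)
    forbidden = concatMap (map φ ∘ seen) uncoloured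

    constraints : List (Fin 67 × Bool)
    constraints = map (λ a → φ a , arc G a v) coloured

    ∉-before : ∀ {a} → a ∉ U → a ≢ v → a ∉ v ∷ U
    ∉-before a∉U a≢v (here a≡v)  = a≢v a≡v
    ∉-before a∉U a≢v (there a∈U) = a∉U a∈U

    ∈-coloured⁻ : ∀ {a} → a ∈ coloured → adj G v a ≡ true × a ∉ v ∷ U
    ∈-coloured⁻ a∈ = let (a∈N , a∉U) = ∈-filter⁻ (_∉? U) {xs = neighbours G v} a∈
                         va = ∈-neighbours⁻ G a∈N
                     in va , ∉-before a∉U (adj⇒≢ G va)

    neighbours-split : length coloured + length uncoloured ≤ 4
    neighbours-split = begin
      length coloured + length uncoloured ≡⟨ +-comm (length coloured) _ ⟩
      length uncoloured + length coloured ≡⟨ length-filter+∁ (_∈? U) (neighbours G v) ⟩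
      length (neighbours G v)             ≡⟨ degree≡length-neighbours G v ⟨
      degree G v                          ≤⟨ degree≤4 v ⟩
      4                                   ∎
      where open ≤-Reasoning

    coloured≤3 : length coloured ≤ 3
    coloured≤3 = from-free free
      where
      from-free : degree G v ≤ 3 ⊎ ∃[ u ] u ∈ U × adj G v u ≡ true → length coloured ≤ 3
      from-free (inj₁ degree≤3) = ≤-trans (length-filter (_∉? U) (neighbours G v))
                                          (subst (_≤ 3) (degree≡length-neighbours G v) degree≤3)
      from-free (inj₂ (u , u∈U , vu)) = +-cancelʳ-≤ 1 (length coloured) 3
        (≤-trans (+-monoʳ-≤ (length coloured) (∈-length (∈-filter⁺ (_∈? U) (∈-neighbours⁺ G vu) u∈U)))
                 neighbours-split)

    seen≤3 : ∀ {w} → w ∈ uncoloured → length (seen w) ≤ 3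
    seen≤3 {w} w∈ = ≤-pred (<-≤-trans
      (filter-notAll (_∉? (v ∷ U)) (neighbours G w) (lose v∈N (λ v∉ → v∉ (here refl))))
      (subst (_≤ 4) (degree≡length-neighbours G w) (degree≤4 w)))
      where
      v∈N : v ∈ neighbours G w
      v∈N = ∈-neighbours⁺ G (trans (adj-sym G w v) (∈-neighbours⁻ G (proj₁ (∈-filter⁻ (_∈? U) w∈))))

    room : length forbidden + 3 * length constraints ≤ 12
    room = begin
      length forbidden + 3 * length constraints ≡⟨ cong (λ k → length forbidden + 3 * k) (length-map _ coloured) ⟩
      length forbidden + 3 * length coloured    ≤⟨ +-monoˡ-≤ (3 * length coloured) forbidden≤ ⟩
      3 * length uncoloured + 3 * length coloured ≡⟨ *-distribˡ-+ 3 (length uncoloured) (length coloured) ⟨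
      3 * (length uncoloured + length coloured) ≡⟨ cong (3 *_) (+-comm (length uncoloured) (length coloured)) ⟩
      3 * (length coloured + length uncoloured) ≤⟨ *-monoʳ-≤ 3 neighbours-split ⟩
      12                                        ∎
      where
      open ≤-Reasoning
      forbidden≤ : length forbidden ≤ 3 * length uncoloured
      forbidden≤ = length-concatMap-≤ (map φ ∘ seen) uncoloured
                     (λ {w} w∈ → subst (_≤ 3) (sym (length-map φ (seen w))) (seen≤3 w∈))

    constraints-distinct : Unique (map proj₁ constraints)
    constraints-distinct = AllPairs.map⁺ (AllPairs.map⁺ (AllPairs-mapWithAll
      (λ (va , a∉) (vb , b∉) a≢b → separating (here refl) a∉ b∉ va vb a≢b)
      (All.tabulate ∈-coloured⁻)
      (Unique.filter⁺ (_∉? U) (neighbours-unique G v))))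

    choice : ∃[ x ] x ∉ forbidden × All (λ (c , b) → QR67-arc⟨ b ⟩ c x) constraints
    choice = QR67-extension constraints (subst (_≤ 3) (sym (length-map _ coloured)) coloured≤3)
                            constraints-distinct forbidden room

    x : Fin 67
    x = proj₁ choice

    ψ : Fin n → Fin 67
    ψ = updateAt φ v (const x)

    ψ-new : ψ v ≡ x
    ψ-new = updateAt-updates v φ

    ψ-old : ∀ {a} → a ≢ v → ψ a ≡ φ a
    ψ-old {a} a≢v = updateAt-minimal a v φ a≢v

    constraint-met : ∀ {a} → adj G v a ≡ true → a ∉ U → QR67-arc⟨ arc G a v ⟩ (φ a) x
    constraint-met va a∉U =
      All.lookup (All.map⁻ (proj₂ (proj₂ choice))) (∈-filter⁺ (_∉? U) (∈-neighbours⁺ G va) a∉U)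

    not-forbidden : ∀ {w b} → w ∈ U → b ∉ v ∷ U → adj G w v ≡ true → adj G w b ≡ true → x ≢ φ b
    not-forbidden {w} {b} w∈U b∉ wv wb x≡φb = proj₁ (proj₂ choice) (subst (_∈ forbidden) (sym x≡φb) φb∈)
      where
      w∈uncoloured : w ∈ uncoloured
      w∈uncoloured = ∈-filter⁺ (_∈? U) (∈-neighbours⁺ G (trans (adj-sym G v w) wv)) w∈U
      b∈seen : b ∈ seen w
      b∈seen = ∈-filter⁺ (_∉? (v ∷ U)) (∈-neighbours⁺ G wb) b∉
      φb∈ : φ b ∈ forbidden
      φb∈ = ∈-concatMap⁺ (map φ ∘ seen) (lose w∈uncoloured (∈-map⁺ φ b∈seen))

    homomorphic′ : ∀ {u w} → u ∉ U → w ∉ U → arc G u w ≡ true → QR67-arc (ψ u) (ψ w)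
    homomorphic′ {u} {w} = by-cases u w (u ≟ᶠ v) (w ≟ᶠ v)
      where
      by-cases : ∀ u w → Dec (u ≡ v) → Dec (w ≡ v) → u ∉ U → w ∉ U → arc G u w ≡ true → QR67-arc (ψ u) (ψ w)
      by-cases u w (yes refl) (yes refl) _ _ uw = contradiction (trans (sym uw) (irreflexive G u)) λ ()
      by-cases u w (yes refl) (no w≢v) _ w∉U uw = subst₂ QR67-arc (sym ψ-new) (sym (ψ-old w≢v))
        (subst (λ b → QR67-arc⟨ b ⟩ (φ w) x) (arc⇒no-reverse G uw) (constraint-met (arc⇒adj G uw) w∉U))
      by-cases u w (no u≢v) (yes refl) u∉U _ uw = subst₂ QR67-arc (sym (ψ-old u≢v)) (sym ψ-new)
        (subst (λ b → QR67-arc⟨ b ⟩ (φ u) x) uw (constraint-met (arc⇒adj⁻ G uw) u∉U))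
      by-cases u w (no u≢v) (no w≢v) u∉U w∉U uw = subst₂ QR67-arc (sym (ψ-old u≢v)) (sym (ψ-old w≢v))
        (homomorphic (∉-before u∉U u≢v) (∉-before w∉U w≢v) uw)

    separating′ : ∀ {w a b} → w ∈ U → a ∉ U → b ∉ U → adj G w a ≡ true → adj G w b ≡ true → a ≢ b → ψ a ≢ ψ b
    separating′ {w} {a} {b} w∈U = by-cases a b (a ≟ᶠ v) (b ≟ᶠ v)
      where
      by-cases : ∀ a b → Dec (a ≡ v) → Dec (b ≡ v) → a ∉ U → b ∉ U → adj G w a ≡ true → adj G w b ≡ true
               → a ≢ b → ψ a ≢ ψ b
      by-cases a b (yes refl) (yes refl) _ _ _ _ a≢b = contradiction refl a≢b
      by-cases a b (yes refl) (no b≢v) _ b∉U wa wb _ ψa≡ψb =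
        not-forbidden w∈U (∉-before b∉U b≢v) wa wb (trans (sym ψ-new) (trans ψa≡ψb (ψ-old b≢v)))
      by-cases a b (no a≢v) (yes refl) a∉U _ wa wb _ ψa≡ψb =
        not-forbidden w∈U (∉-before a∉U a≢v) wb wa (trans (sym ψ-new) (trans (sym ψa≡ψb) (ψ-old a≢v)))
      by-cases a b (no a≢v) (no b≢v) a∉U b∉U wa wb a≢b ψa≡ψb =
        separating (there w∈U) (∉-before a∉U a≢v) (∉-before b∉U b≢v) wa wb a≢b
                   (trans (sym (ψ-old a≢v)) (trans ψa≡ψb (ψ-old b≢v)))

    extended : Admissible U ψ
    extended = record { homomorphic = homomorphic′ ; separating = separating′ }

  colour-next : ∀ {v U φ} → Admissible (v ∷ U) φ
              → degree G v ≤ 3 ⊎ (∃[ u ] u ∈ U × adj G v u ≡ true) → ∃[ ψ ] Admissible U ψ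
  colour-next admissible free = Step.ψ admissible free , Step.extended admissible free

  colour-along : ∀ {r U φ} → RootedOrder G r U → degree G r ≤ 3 → Admissible U φ → ∃[ ψ ] Admissible [] ψ
  colour-along root r-free admissible = colour-next admissible (inj₁ r-free)
  colour-along (grow order _ u∈vs vu) r-free admissible =
    colour-along order r-free (proj₂ (colour-next admissible (inj₂ (_ , u∈vs , vu))))

mainTheorem6 : ∀ (n : ℕ) (G : OrientedGraph n) → Connected G
                 → (∀ (v : Fin n) → degree G v ≤ 4)
                 → (∃[ v ] degree G v ≤ 3)
                 → ∃[ φ ] IsHomToQR67 G φ
mainTheorem6 n G connected degree≤4 (r , r-free) =
  let (vs , order , spanning) = spanning-order G connected r
      (ψ , admissible) = colour-along order r-free (nothing-coloured (const fzero) spanning)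
  in ψ , λ u w → homomorphic admissible (λ ()) (λ ())
  where open Colouring G degree≤4
        open Admissible
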